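{- Let $\boldsymbol{Z}=\{z_{i,j}\in\mathbb{F}^2: i,j\in\mathbb{N}\}$ be a node set. For $i,j\in\mathbb{N}$ let $\boldsymbol{L}^i\boldsymbol{D}^j\boldsymbol{Z}=\{w_{a,b}=z_{a+i,b+j}: a,b\in\mathbb{N}\}$. Then for all $m,n,i,j\in\mathbb{N}$, $$\Delta_x^i\Delta_y^j\tilde g_{m,n}((x,y);\boldsymbol{Z})=(m)_i\,(n)_j\,\tilde g_{m-i,n-j}((x,y);\boldsymbol{L}^i\boldsymbol{D}^j\boldsymbol{Z}),$$ where $(t)_k=t(t-1)\cdots(t-k+1)$ is the lower factorial, and the right-hand side is interpreted as $0$ when $i>m$ or $j>n$.
   Context: $\mathbb{F}$ is a field of characteristic zero. For $p\in\mathbb{F}[x,y]$, $\Delta_x p(x,y)=p(x,y)-p(x-1,y)$ and $\Delta_y p(x,y)=p(x,y)-p(x,y-1)$. For $z\in\mathbb{F}^2$, $\varepsilon(z)$ denotes evaluation at $(x,y)=z$. Write $(i,j)\preceq(m,n)$ if $i\le m$ and $j\le n$. $\Pi^2_{m,n}$ is the space of polynomials of degree at most $m$ in $x$ and at most $n$ in $y$. For a node set $\boldsymbol{W}=\{w_{i,j}\}$ and $m,n\in\mathbb{N}$, $\tilde g_{m,n}((x,y);\boldsymbol{W})$ is the unique polynomial in $\Pi^2_{m,n}$ with $\varepsilon(w_{i,j})\Delta_x^i\Delta_y^j\tilde g_{m,n}((x,y);\boldsymbol{W})=m!\,n!\,\delta_{m,i}\delta_{n,j}$ for all $(i,j)\preceq(m,n)$.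 -}

module Defs where

open import Level using (Level; _⊔_)
open import Algebra.Bundles using (CommutativeRing)
open import Data.Nat using (ℕ; zero; suc; _≡ᵇ_; _!)
  renaming (_*_ to _*ℕ_; _+_ to _+ℕ_)
open import Data.Fin using (Fin; toℕ)
  renaming (zero to fzero; suc to fsuc)
open import Data.Bool using (if_then_else_)
open import Data.Product using (_×_; _,_; ∃)
open import Relation.Nullary using (¬_)

falling : ℕ → ℕ → ℕ
falling t zero = 1
falling zero (suc k) = 0
falling (suc t) (suc k) = suc t *ℕ falling t k

iter : ∀ {a} {A : Set a} → ℕ → (A → A) → A → A
iter zero f x = x
iter (suc k) f x = f (iter k f x)

module _ {c ℓ : Level} (R : CommutativeRing c ℓ) where
  open CommutativeRing R

  ι : ℕ → Carrier
  ι zero = 0#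
  ι (suc n) = 1# + ι n

  IsField : Set (c ⊔ ℓ)
  IsField = (¬ (1# ≈ 0#)) × (∀ x → ¬ (x ≈ 0#) → ∃ λ y → x * y ≈ 1#)

  CharZero : Set ℓ
  CharZero = ∀ n → ¬ (ι (suc n) ≈ 0#)

  pow : Carrier → ℕ → Carrier
  pow x zero = 1#
  pow x (suc k) = x * pow x k

  sumFin : ∀ k → (Fin k → Carrier) → Carrier
  sumFin zero f = 0#
  sumFin (suc k) f = f fzero + sumFin k (λ i → f (fsuc i))

  -- Π²_{m,n}: polynomials of degree ≤ m in x and ≤ n in y,
  -- given by their coefficients: p(x,y) = Σ_{a≤m,b≤n} coeff a b · x^a y^b
  Poly : ℕ → ℕ → Set c
  Poly m n = Fin (suc m) → Fin (suc n) → Carrier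

  ⟦_⟧ : ∀ {m n} → Poly m n → Carrier → Carrier → Carrier
  ⟦_⟧ {m} {n} p x y =
    sumFin (suc m) λ a → sumFin (suc n) λ b → p a b * (pow x (toℕ a) * pow y (toℕ b))

  Δx : (Carrier → Carrier → Carrier) → Carrier → Carrier → Carrier
  Δx f x y = f x y - f (x - 1#) y

  Δy : (Carrier → Carrier → Carrier) → Carrier → Carrier → Carrier
  Δy f x y = f x y - f x (y - 1#)

  Δxy : ℕ → ℕ → (Carrier → Carrier → Carrier) → Carrier → Carrier → Carrier
  Δxy i j f = iter i Δx (iter j Δy f)

  NodeSet : Set c
  NodeSet = ℕ → ℕ → Carrier × Carrier

  ε : (Carrier → Carrier → Carrier) → Carrier × Carrier → Carrier
  ε f (u , v) = f u v

  δ : ℕ → ℕ → Carrier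
  δ a b = if a ≡ᵇ b then 1# else 0#

  IsGtilde : (m n : ℕ) → NodeSet → Poly m n → Set ℓ
  IsGtilde m n W p =
    (i : Fin (suc m)) (j : Fin (suc n)) →
      ε (Δxy (toℕ i) (toℕ j) ⟦ p ⟧) (W (toℕ i) (toℕ j))
        ≈ ι ((m !) *ℕ (n !)) * (δ m (toℕ i) * δ n (toℕ j))

LD : ∀ {a} {A : Set a} → ℕ → ℕ → (ℕ → ℕ → A) → ℕ → ℕ → A
LD i j Z a b = Z (a +ℕ i) (b +ℕ j)

-- Write polynomials of bidegree at most (k, l) in the rising-factorial basis x⁽ᵃ⁾ y⁽ᵇ⁾,
-- x⁽ᵃ⁾ = x (x + 1) ⋯ (x + a - 1), on which backward differences act as scaled coefficient
-- shifts: Δ x⁽ᵃ⁺¹⁾ = (a + 1) x⁽ᵃ⁾. So Δ_x^i Δ_y^j maps Π²_{m,n} into Π²_{m-i,n-j}, and to 0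
-- when i > m or j > n. When the positive integers cancel (characteristic zero), a
-- p ∈ Π²_{k,l} with ε(w_{a,b}) Δ_x^a Δ_y^b p = 0 for all (a,b) ⪯ (k,l) vanishes: Δ_x p,
-- on the nodes shifted by one, is again such a polynomial of lower degree, and the
-- constant term is read off at w_{0,0}. As Δ_x^a Δ_y^b Δ_x^i Δ_y^j = Δ_x^{a+i} Δ_y^{b+j},
-- the data of Δ_x^i Δ_y^j g̃_{m,n}(·; Z) on L^i D^j Z are m! n! δ_{m,a+i} δ_{n,b+j}
-- = (m)_i (n)_j (m-i)! (n-j)! δ_{m-i,a} δ_{n-j,b}, those of (m)_i (n)_j g̃_{m-i,n-j}.

module Submission where

open import Level using (Level)
open import Algebra.Bundles using (CommutativeRing)
open import Data.Nat as ℕ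
  using (ℕ; zero; suc; pred; _∸_; _!; _≤_; _<_; _≤′_; ≤′-refl; ≤′-step; z≤n; s≤s)
import Data.Nat
import Data.Nat.Properties as ℕP
open import Data.Integer as ℤ using (ℤ; +_; -[1+_]; _⊖_; _◃_; sign; ∣_∣)
import Data.Integer.Properties as ℤP
open import Data.Sign as Sign using (Sign)
open import Data.Fin using (Fin; fromℕ<) renaming (zero to fzero; suc to fsuc)
import Data.Fin.Properties as FinP
open import Data.Maybe using (Maybe; just; nothing)
open import Data.Product using (∃; _×_; _,_)
open import Data.Sum using (_⊎_; inj₁; inj₂)
open import Function using (_∘_)
open import Relation.Nullary using (yes; no)
open import Relation.Binary.PropositionalEquality as ≡ using (_≡_)
open import Algebra.Solver.Ring.AlmostCommutativeRing
  using (_-Raw-AlmostCommutative⟶_; fromCommutativeRing)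
open import Defs

-- The ring solver needs coefficients with decidable equality; ℤ serves, through the
-- canonical homomorphism ℤ → R.
module IntegerCoefficients {c ℓ : Level} (R : CommutativeRing c ℓ) where
  open CommutativeRing R
  open import Algebra.Properties.Ring ring
    using (-0#≈0#; -‿involutive; -‿+-comm; -‿anti-homo-+; xyx⁻¹≈y; -1*x≈-x)
  open import Algebra.Properties.CommutativeSemigroup *-commutativeSemigroup
    using (interchange)
  open import Algebra.Properties.Semiring.Mult.TCOptimised semiring
    using (1+×; ×-homo-+; ×1-homo-*) renaming (_×_ to _×′_)
  open import Relation.Binary.Reasoning.Setoid setoid

  ⟦_⟧ℤ : ℤ → Carrier
  ⟦ + n ⟧ℤ = n ×′ 1#
  ⟦ -[1+ n ] ⟧ℤ = - (suc n ×′ 1#)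

  ⊖-homo : ∀ m n → ⟦ m ⊖ n ⟧ℤ ≈ m ×′ 1# - n ×′ 1#
  ⊖-homo m zero = sym (trans (+-congˡ -0#≈0#) (+-identityʳ _))
  ⊖-homo zero (suc n) = sym (+-identityˡ _)
  ⊖-homo (suc m) (suc n) = begin
    ⟦ suc m ⊖ suc n ⟧ℤ                    ≡⟨ ≡.cong ⟦_⟧ℤ (ℤP.[1+m]⊖[1+n]≡m⊖n m n) ⟩
    ⟦ m ⊖ n ⟧ℤ                            ≈⟨ ⊖-homo m n ⟩
    m ×′ 1# - n ×′ 1#                     ≈⟨ xyx⁻¹≈y 1# _ ⟨
    (1# + (m ×′ 1# - n ×′ 1#)) - 1#       ≈⟨ trans (+-congʳ (sym (+-assoc _ _ _))) (+-assoc _ _ _) ⟩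
    (1# + m ×′ 1#) + (- (n ×′ 1#) - 1#)   ≈⟨ +-cong (1+× m 1#) (trans (-‿cong (1+× n 1#)) (-‿anti-homo-+ 1# _)) ⟨
    suc m ×′ 1# - suc n ×′ 1#             ∎

  sgn : Sign → Carrier
  sgn Sign.+ = 1#
  sgn Sign.- = - 1#

  sgn-homo : ∀ s t → sgn (s Sign.* t) ≈ sgn s * sgn t
  sgn-homo Sign.+ t = sym (*-identityˡ _)
  sgn-homo Sign.- Sign.+ = sym (*-identityʳ _)
  sgn-homo Sign.- Sign.- = trans (sym (-‿involutive 1#)) (sym (-1*x≈-x _))

  ◃-homo : ∀ s n → ⟦ s ◃ n ⟧ℤ ≈ sgn s * n ×′ 1#
  ◃-homo s zero = sym (zeroʳ _)
  ◃-homo Sign.+ (suc n) = sym (*-identityˡ _)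
  ◃-homo Sign.- (suc n) = sym (-1*x≈-x _)

  sign-abs-homo : ∀ i → ⟦ i ⟧ℤ ≈ sgn (sign i) * ∣ i ∣ ×′ 1#
  sign-abs-homo i =
    trans (reflexive (≡.cong ⟦_⟧ℤ (≡.sym (ℤP.◃-inverse i)))) (◃-homo (sign i) ∣ i ∣)

  +-homo : ∀ i j → ⟦ i ℤ.+ j ⟧ℤ ≈ ⟦ i ⟧ℤ + ⟦ j ⟧ℤ
  +-homo -[1+ m ] -[1+ n ] = begin
    - (suc (suc (m ℕ.+ n)) ×′ 1#)    ≡⟨ ≡.cong (λ k → - (k ×′ 1#)) (≡.sym (ℕP.+-suc (suc m) n)) ⟩
    - ((suc m ℕ.+ suc n) ×′ 1#)      ≈⟨ -‿cong (×-homo-+ 1# (suc m) (suc n)) ⟩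
    - (suc m ×′ 1# + suc n ×′ 1#)    ≈⟨ -‿+-comm _ _ ⟨
    - (suc m ×′ 1#) - suc n ×′ 1#    ∎
  +-homo -[1+ m ] (+ n) = trans (⊖-homo n (suc m)) (+-comm _ _)
  +-homo (+ m) -[1+ n ] = ⊖-homo m (suc n)
  +-homo (+ m) (+ n) = ×-homo-+ 1# m n

  *-homo : ∀ i j → ⟦ i ℤ.* j ⟧ℤ ≈ ⟦ i ⟧ℤ * ⟦ j ⟧ℤ
  *-homo i j = begin
    ⟦ sign i Sign.* sign j ◃ ∣ i ∣ ℕ.* ∣ j ∣ ⟧ℤ
      ≈⟨ ◃-homo (sign i Sign.* sign j) (∣ i ∣ ℕ.* ∣ j ∣) ⟩
    sgn (sign i Sign.* sign j) * (∣ i ∣ ℕ.* ∣ j ∣) ×′ 1#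
      ≈⟨ *-cong (sgn-homo (sign i) (sign j)) (×1-homo-* ∣ i ∣ ∣ j ∣) ⟩
    (sgn (sign i) * sgn (sign j)) * (∣ i ∣ ×′ 1# * ∣ j ∣ ×′ 1#)
      ≈⟨ interchange _ _ _ _ ⟩
    (sgn (sign i) * ∣ i ∣ ×′ 1#) * (sgn (sign j) * ∣ j ∣ ×′ 1#)
      ≈⟨ *-cong (sign-abs-homo i) (sign-abs-homo j) ⟨
    ⟦ i ⟧ℤ * ⟦ j ⟧ℤ
      ∎

  -‿homo : ∀ i → ⟦ ℤ.- i ⟧ℤ ≈ - ⟦ i ⟧ℤ
  -‿homo -[1+ n ] = sym (-‿involutive _)
  -‿homo (+ zero) = sym -0#≈0#
  -‿homo (+ suc n) = refl

  homomorphism : ℤ.+-*-rawRing -Raw-AlmostCommutative⟶ fromCommutativeRing R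
  homomorphism = record
    { ⟦_⟧ = ⟦_⟧ℤ ; +-homo = +-homo ; *-homo = *-homo ; -‿homo = -‿homo
    ; 0-homo = refl ; 1-homo = refl }

  ⟦⟧ℤ-≟ : ∀ i j → Maybe (⟦ i ⟧ℤ ≈ ⟦ j ⟧ℤ)
  ⟦⟧ℤ-≟ i j with i ℤP.≟ j
  ... | yes ≡.refl = just refl
  ... | no _ = nothing

  open import Algebra.Solver.Ring ℤ.+-*-rawRing (fromCommutativeRing R) homomorphism ⟦⟧ℤ-≟
    public using (solve; _:=_; _:+_; _:-_; _:*_; con)

iter-comm : ∀ {a} {A : Set a} (f : A → A) k x → iter k f (f x) ≡ iter (suc k) f x
iter-comm f zero x = ≡.refl
iter-comm f (suc k) x = ≡.cong f (iter-comm f k x)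

iter-+ : ∀ {a} {A : Set a} (f : A → A) k i x → iter (k ℕ.+ i) f x ≡ iter k f (iter i f x)
iter-+ f zero i x = ≡.refl
iter-+ f (suc k) i x = ≡.cong f (iter-+ f k i x)

iter-∸ : ∀ {a p} {A : Set a} (P : ℕ → A → Set p) (f : A → A) →
         (∀ {k x} → P k x → P (pred k) (f x)) → ∀ i {k x} → P k x → P (k ∸ i) (iter i f x)
iter-∸ P f step zero Pkx = Pkx
iter-∸ P f step (suc i) {k} {x} Pkx =
  ≡.subst (λ k′ → P k′ (iter (suc i) f x)) (ℕP.pred[m∸n]≡m∸[1+n] k i)
          (step (iter-∸ P f step i Pkx))

falling*[m∸i]!≡m! : ∀ {m i} → i ≤ m → falling m i ℕ.* (m ∸ i) ! ≡ m !
falling*[m∸i]!≡m! {m} z≤n = ℕP.*-identityˡ (m !)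
falling*[m∸i]!≡m! {suc m} {suc i} (s≤s i≤m) =
  ≡.trans (ℕP.*-assoc (suc m) (falling m i) ((m ∸ i) !))
          (≡.cong (suc m ℕ.*_) (falling*[m∸i]!≡m! i≤m))

module RisingFactorials {c ℓ : Level} (F : CommutativeRing c ℓ) where
  open CommutativeRing F
  open IntegerCoefficients F
  open import Relation.Binary.Reasoning.Setoid setoid

  rising : ℕ → Carrier → Carrier
  rising zero x = 1#
  rising (suc a) x = rising a x * (x + ι F a)

  risingSum : ℕ → (ℕ → Carrier) → Carrier → Carrier
  risingSum zero d x = 0#
  risingSum (suc n) d x = risingSum n d x + d n * rising n x

  risingSum-cong : ∀ n {d e} x → (∀ b → b < n → d b ≈ e b) → risingSum n d x ≈ risingSum n e x
  risingSum-cong zero x d≈e = refl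
  risingSum-cong (suc n) x d≈e =
    +-cong (risingSum-cong n x (λ b b<n → d≈e b (ℕP.m<n⇒m<1+n b<n))) (*-congʳ (d≈e n ℕP.≤-refl))

  risingSum-+ : ∀ n d e x → risingSum n d x + risingSum n e x ≈ risingSum n (λ b → d b + e b) x
  risingSum-+ zero d e x = +-identityˡ 0#
  risingSum-+ (suc n) d e x = trans
    (solve 5 (λ P Q p q r → (P :+ p :* r) :+ (Q :+ q :* r) := (P :+ Q) :+ (p :+ q) :* r)
           refl (risingSum n d x) (risingSum n e x) (d n) (e n) (rising n x))
    (+-congʳ (risingSum-+ n d e x))

  risingSum-sub : ∀ n d e x → risingSum n d x - risingSum n e x ≈ risingSum n (λ b → d b - e b) x
  risingSum-sub zero d e x = -‿inverseʳ 0#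
  risingSum-sub (suc n) d e x = trans
    (solve 5 (λ P Q p q r → (P :+ p :* r) :- (Q :+ q :* r) := (P :- Q) :+ (p :- q) :* r)
           refl (risingSum n d x) (risingSum n e x) (d n) (e n) (rising n x))
    (+-congʳ (risingSum-sub n d e x))

  *-risingSum : ∀ n k d x → k * risingSum n d x ≈ risingSum n (λ b → k * d b) x
  *-risingSum zero k d x = zeroʳ k
  *-risingSum (suc n) k d x =
    trans (distribˡ k _ _) (+-cong (*-risingSum n k d x) (sym (*-assoc k _ _)))

  risingSum-truncate : ∀ {a n d x} → a ≤′ n → (∀ b → a ≤ b → b < n → d b ≈ 0#) →
                       risingSum n d x ≈ risingSum a d x
  risingSum-truncate ≤′-refl vanish = refl
  risingSum-truncate {a} {suc n} {d} {x} (≤′-step a≤′n) vanish = begin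
    risingSum n d x + d n * rising n x
      ≈⟨ +-congˡ (trans (*-congʳ (vanish n (ℕP.≤′⇒≤ a≤′n) ℕP.≤-refl)) (zeroˡ _)) ⟩
    risingSum n d x + 0#
      ≈⟨ +-identityʳ _ ⟩
    risingSum n d x
      ≈⟨ risingSum-truncate a≤′n (λ b a≤b b<n → vanish b a≤b (ℕP.m<n⇒m<1+n b<n)) ⟩
    risingSum a d x
      ∎

  risingSum-zero : ∀ n {d} x → (∀ b → b < n → d b ≈ 0#) → risingSum n d x ≈ 0#
  risingSum-zero n x vanish = risingSum-truncate (ℕP.≤⇒≤′ z≤n) (λ b _ → vanish b)

  rising-suc-pred : ∀ a x → rising (suc a) (x - 1#) ≈ (x - 1#) * rising a x
  rising-suc-pred zero x =
    solve 1 (λ y → con (+ 1) :* (y :+ con (+ 0)) := y :* con (+ 1)) refl (x - 1#)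
  rising-suc-pred (suc a) x = begin
    rising (suc a) (x - 1#) * ((x - 1#) + ι F (suc a))
      ≈⟨ *-congʳ (rising-suc-pred a x) ⟩
    ((x - 1#) * rising a x) * ((x - 1#) + ι F (suc a))
      ≈⟨ solve 3 (λ x r k → ((x :- con (+ 1)) :* r) :* ((x :- con (+ 1)) :+ (con (+ 1) :+ k))
                            := (x :- con (+ 1)) :* (r :* (x :+ k)))
               refl x (rising a x) (ι F a) ⟩
    (x - 1#) * rising (suc a) x
      ∎

  Δrising : ∀ a x → rising (suc a) x - rising (suc a) (x - 1#) ≈ ι F (suc a) * rising a x
  Δrising a x = begin
    rising a x * (x + ι F a) - rising (suc a) (x - 1#)
      ≈⟨ +-congˡ (-‿cong (rising-suc-pred a x)) ⟩
    rising a x * (x + ι F a) - (x - 1#) * rising a x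
      ≈⟨ solve 3 (λ r x k → r :* (x :+ k) :- (x :- con (+ 1)) :* r := (con (+ 1) :+ k) :* r)
               refl (rising a x) x (ι F a) ⟩
    ι F (suc a) * rising a x
      ∎

  Δcoefficients : (ℕ → Carrier) → ℕ → Carrier
  Δcoefficients d b = ι F (suc b) * d (suc b)

  ΔrisingSum : ∀ n d x →
               risingSum n d x - risingSum n d (x - 1#) ≈ risingSum (pred n) (Δcoefficients d) x
  ΔrisingSum zero d x = -‿inverseʳ 0#
  ΔrisingSum (suc zero) d x = -‿inverseʳ _
  ΔrisingSum (suc (suc n)) d x = begin
    (P + d (suc n) * rising (suc n) x) - (P' + d (suc n) * rising (suc n) (x - 1#))
      ≈⟨ solve 5 (λ P P' e U V → (P :+ e :* U) :- (P' :+ e :* V) := (P :- P') :+ e :* (U :- V))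
               refl P P' (d (suc n)) (rising (suc n) x) (rising (suc n) (x - 1#)) ⟩
    (P - P') + d (suc n) * (rising (suc n) x - rising (suc n) (x - 1#))
      ≈⟨ +-cong (ΔrisingSum (suc n) d x) (*-congˡ (Δrising n x)) ⟩
    risingSum n (Δcoefficients d) x + d (suc n) * (ι F (suc n) * rising n x)
      ≈⟨ +-congˡ (trans (sym (*-assoc _ _ _)) (*-congʳ (*-comm _ _))) ⟩
    risingSum (suc n) (Δcoefficients d) x ∎
    where
    P = risingSum (suc n) d x
    P' = risingSum (suc n) d (x - 1#)

  -- the coefficients of x · Σ d b x⁽ᵇ⁾, by x · x⁽ᵇ⁾ = x⁽ᵇ⁺¹⁾ - b x⁽ᵇ⁾
  timesX : (ℕ → Carrier) → ℕ → Carrier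
  timesX d zero = 0#
  timesX d (suc b) = d b - ι F (suc b) * d (suc b)

  x*risingSum : ∀ n d x →
                x * risingSum n d x ≈ risingSum (suc n) (timesX d) x + ι F n * d n * rising n x
  x*risingSum zero d x =
    solve 2 (λ x d → x :* con (+ 0) := (con (+ 0) :+ con (+ 0) :* con (+ 1)) :+ con (+ 0) :* d :* con (+ 1))
            refl x (d 0)
  x*risingSum (suc n) d x = begin
    x * (risingSum n d x + d n * rising n x)
      ≈⟨ trans (distribˡ x _ _) (+-congˡ (x∙yz≈y∙xz x (d n) _)) ⟩
    x * risingSum n d x + d n * (x * rising n x)
      ≈⟨ +-congʳ (x*risingSum n d x) ⟩
    (risingSum (suc n) (timesX d) x + ι F n * d n * rising n x) + d n * (x * rising n x)
      ≈⟨ solve 7 (λ Q k e r x k' f → (Q :+ k :* e :* r) :+ e :* (x :* r)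
                    := (Q :+ (e :- k' :* f) :* (r :* (x :+ k))) :+ k' :* f :* (r :* (x :+ k)))
               refl (risingSum (suc n) (timesX d) x) (ι F n) (d n) (rising n x) x (ι F (suc n)) (d (suc n)) ⟩
    risingSum (suc (suc n)) (timesX d) x + ι F (suc n) * d (suc n) * rising (suc n) x ∎
    where open import Algebra.Properties.CommutativeSemigroup *-commutativeSemigroup using (x∙yz≈y∙xz)

  pow-risingSum : ∀ a → ∃ λ d → (∀ b → a < b → d b ≈ 0#) × (∀ x → pow F x a ≈ risingSum (suc a) d x)
  pow-risingSum zero =
    δ F 0 , (λ { (suc b) _ → refl }) , λ x → sym (trans (+-identityˡ _) (*-identityʳ _))
  pow-risingSum (suc a) with pow-risingSum a
  ... | d , vanish , pow≈ = timesX d , vanish′ , pow≈′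
    where
    vanish′ : ∀ b → suc a < b → timesX d b ≈ 0#
    vanish′ (suc b) (s≤s a<b) = begin
      d b - ι F (suc b) * d (suc b)
        ≈⟨ +-cong (vanish b a<b) (-‿cong (trans (*-congˡ (vanish (suc b) (ℕP.m<n⇒m<1+n a<b))) (zeroʳ _))) ⟩
      0# - 0#
        ≈⟨ -‿inverseʳ 0# ⟩
      0#
        ∎
    pow≈′ : ∀ x → pow F x (suc a) ≈ risingSum (suc (suc a)) (timesX d) x
    pow≈′ x = begin
      x * pow F x a
        ≈⟨ *-congˡ (pow≈ x) ⟩
      x * risingSum (suc a) d x
        ≈⟨ x*risingSum (suc a) d x ⟩
      risingSum (suc (suc a)) (timesX d) x + ι F (suc a) * d (suc a) * rising (suc a) x
        ≈⟨ +-congˡ (trans (*-congʳ (trans (*-congˡ (vanish (suc a) ℕP.≤-refl)) (zeroʳ _))) (zeroˡ _)) ⟩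
      risingSum (suc (suc a)) (timesX d) x + 0#
        ≈⟨ +-identityʳ _ ⟩
      risingSum (suc (suc a)) (timesX d) x
        ∎

  pow-risingSum-< : ∀ {a n} → a < n → ∃ λ d → ∀ x → pow F x a ≈ risingSum n d x
  pow-risingSum-< {a} a<n with pow-risingSum a
  ... | d , vanish , pow≈ =
    d , λ x → trans (pow≈ x) (sym (risingSum-truncate (ℕP.≤⇒≤′ a<n) (λ b a<b _ → vanish b a<b)))

  Fn : Set c
  Fn = Carrier → Carrier → Carrier

  infix 4 _≐_
  _≐_ : Fn → Fn → Set (c Level.⊔ ℓ)
  f ≐ g = ∀ x y → f x y ≈ g x y

  ≐-sym : ∀ {f g} → f ≐ g → g ≐ f
  ≐-sym f≐g x y = sym (f≐g x y)

  ≐-trans : ∀ {f g h} → f ≐ g → g ≐ h → f ≐ h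
  ≐-trans f≐g g≐h x y = trans (f≐g x y) (g≐h x y)

  risingSum² : ℕ → ℕ → (ℕ → ℕ → Carrier) → Fn
  risingSum² k l cf x y = risingSum k (λ a → risingSum l (cf a) y) x

  -- Span (suc m) (suc n) is Π²_{m,n}, with the basis x⁽ᵃ⁾ y⁽ᵇ⁾ in place of xᵃ yᵇ.
  record Span (k l : ℕ) (f : Fn) : Set (c Level.⊔ ℓ) where
    constructor span
    field
      coefficients : ℕ → ℕ → Carrier
      expansion : f ≐ risingSum² k l coefficients

  Span-cong : ∀ {k l f g} → f ≐ g → Span k l g → Span k l f
  Span-cong f≐g (span cf g≐) = span cf (≐-trans f≐g g≐)

  Span-zero : ∀ {k l} → Span k l (λ _ _ → 0#)
  Span-zero {k} {l} = span (λ _ _ → 0#) λ x y →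
    sym (risingSum-zero k x (λ a _ → risingSum-zero l y (λ _ _ → refl)))

  Span-+ : ∀ {k l f g} → Span k l f → Span k l g → Span k l (λ x y → f x y + g x y)
  Span-+ {k} {l} (span cf f≐) (span cg g≐) = span (λ a b → cf a b + cg a b) λ x y → begin
    _ + _
      ≈⟨ +-cong (f≐ x y) (g≐ x y) ⟩
    risingSum² k l cf x y + risingSum² k l cg x y
      ≈⟨ risingSum-+ k _ _ x ⟩
    risingSum k (λ a → risingSum l (cf a) y + risingSum l (cg a) y) x
      ≈⟨ risingSum-cong k x (λ a _ → risingSum-+ l (cf a) (cg a) y) ⟩
    risingSum² k l (λ a b → cf a b + cg a b) x y
      ∎

  Span-* : ∀ {k l f} z → Span k l f → Span k l (λ x y → z * f x y)
  Span-* {k} {l} z (span cf f≐) = span (λ a b → z * cf a b) λ x y → begin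
    z * _
      ≈⟨ *-congˡ (f≐ x y) ⟩
    z * risingSum² k l cf x y
      ≈⟨ *-risingSum k z _ x ⟩
    risingSum k (λ a → z * risingSum l (cf a) y) x
      ≈⟨ risingSum-cong k x (λ a _ → *-risingSum l z (cf a) y) ⟩
    risingSum² k l (λ a b → z * cf a b) x y
      ∎

  Span-monomial : ∀ {a b k l} → a < k → b < l → Span k l (λ x y → pow F x a * pow F y b)
  Span-monomial {a} {b} {k} {l} a<k b<l with pow-risingSum-< a<k | pow-risingSum-< b<l
  ... | d , powx≈ | e , powy≈ = span (λ a′ b′ → d a′ * e b′) λ x y → begin
    pow F x a * pow F y b
      ≈⟨ *-cong (powx≈ x) (powy≈ y) ⟩
    risingSum k d x * risingSum l e y
      ≈⟨ *-comm _ _ ⟩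
    risingSum l e y * risingSum k d x
      ≈⟨ *-risingSum k _ d x ⟩
    risingSum k (λ a′ → risingSum l e y * d a′) x
      ≈⟨ risingSum-cong k x (λ a′ _ → trans (*-comm _ _) (*-risingSum l (d a′) e y)) ⟩
    risingSum² k l (λ a′ b′ → d a′ * e b′) x y
      ∎

  Span-sumFin : ∀ {k l} N (f : Fin N → Fn) → (∀ t → Span k l (f t)) →
                Span k l (λ x y → sumFin F N (λ t → f t x y))
  Span-sumFin zero f spans = Span-zero
  Span-sumFin (suc N) f spans = Span-+ (spans fzero) (Span-sumFin N (f ∘ fsuc) (spans ∘ fsuc))

  Span-poly : ∀ {m n} (p : Poly F m n) → Span (suc m) (suc n) (⟦_⟧ F p)
  Span-poly {m} {n} p = Span-sumFin (suc m) _ λ a → Span-sumFin (suc n) _ λ b →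
    Span-* (p a b) (Span-monomial (s≤s (FinP.toℕ≤pred[n] a)) (s≤s (FinP.toℕ≤pred[n] b)))

  Span-zeroˡ : ∀ {l f} → Span 0 l f → f ≐ λ _ _ → 0#
  Span-zeroˡ = Span.expansion

  Span-zeroʳ : ∀ {k f} → Span k 0 f → f ≐ λ _ _ → 0#
  Span-zeroʳ {k} (span cf f≐) x y = trans (f≐ x y) (risingSum-zero k x (λ _ _ → refl))

  Δx-cong : ∀ {f g} → f ≐ g → Δx F f ≐ Δx F g
  Δx-cong f≐g x y = +-cong (f≐g x y) (-‿cong (f≐g (x - 1#) y))

  Δy-cong : ∀ {f g} → f ≐ g → Δy F f ≐ Δy F g
  Δy-cong f≐g x y = +-cong (f≐g x y) (-‿cong (f≐g x (y - 1#)))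

  Span-Δx : ∀ {k l f} → Span k l f → Span (pred k) l (Δx F f)
  Span-Δx {k} {l} {f} (span cf f≐) = span (λ a b → Δcoefficients (λ a′ → cf a′ b) a) λ x y → begin
    Δx F f x y
      ≈⟨ Δx-cong f≐ x y ⟩
    risingSum k (g y) x - risingSum k (g y) (x - 1#)
      ≈⟨ ΔrisingSum k (g y) x ⟩
    risingSum (pred k) (Δcoefficients (g y)) x
      ≈⟨ risingSum-cong (pred k) x (λ a _ → *-risingSum l _ (cf (suc a)) y) ⟩
    risingSum² (pred k) l _ x y
      ∎
    where
    g : Carrier → ℕ → Carrier
    g y a = risingSum l (cf a) y

  Span-Δy : ∀ {k l f} → Span k l f → Span k (pred l) (Δy F f)
  Span-Δy {k} {l} {f} (span cf f≐) = span (Δcoefficients ∘ cf) λ x y → begin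
    Δy F f x y
      ≈⟨ Δy-cong f≐ x y ⟩
    risingSum k (λ a → g a y) x - risingSum k (λ a → g a (y - 1#)) x
      ≈⟨ risingSum-sub k _ _ x ⟩
    risingSum k (λ a → g a y - g a (y - 1#)) x
      ≈⟨ risingSum-cong k x (λ a _ → ΔrisingSum l (cf a) y) ⟩
    risingSum² k (pred l) (Δcoefficients ∘ cf) x y
      ∎
    where
    g : ℕ → Carrier → Carrier
    g a = risingSum l (cf a)

  Span-Δxy : ∀ {k l f} i j → Span k l f → Span (k ∸ i) (l ∸ j) (Δxy F i j f)
  Span-Δxy {k} {l} i j s =
    iter-∸ (λ k′ → Span k′ (l ∸ j)) (Δx F) Span-Δx i (iter-∸ (Span k) (Δy F) Span-Δy j s)

  iter-cong : ∀ {D : Fn → Fn} → (∀ {f g} → f ≐ g → D f ≐ D g) →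
              ∀ i {f g} → f ≐ g → iter i D f ≐ iter i D g
  iter-cong D-cong zero f≐g = f≐g
  iter-cong D-cong (suc i) f≐g = D-cong (iter-cong D-cong i f≐g)

  ≡⇒≐ : ∀ {f g} → f ≡ g → f ≐ g
  ≡⇒≐ ≡.refl x y = refl

  Δxy-cong : ∀ i j {f g} → f ≐ g → Δxy F i j f ≐ Δxy F i j g
  Δxy-cong i j f≐g = iter-cong Δx-cong i (iter-cong Δy-cong j f≐g)

  Δy-Δx-comm : ∀ f → Δy F (Δx F f) ≐ Δx F (Δy F f)
  Δy-Δx-comm f x y = solve 4 (λ a b c d → (a :- b) :- (c :- d) := (a :- c) :- (b :- d))
                       refl (f x y) (f (x - 1#) y) (f x (y - 1#)) (f (x - 1#) (y - 1#))

  Δyʲ-Δx-comm : ∀ j f → iter j (Δy F) (Δx F f) ≐ Δx F (iter j (Δy F) f)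
  Δyʲ-Δx-comm zero f x y = refl
  Δyʲ-Δx-comm (suc j) f = ≐-trans (Δy-cong (Δyʲ-Δx-comm j f)) (Δy-Δx-comm _)

  Δyʲ-Δxⁱ-comm : ∀ j i f → iter j (Δy F) (iter i (Δx F) f) ≐ iter i (Δx F) (iter j (Δy F) f)
  Δyʲ-Δxⁱ-comm j zero f x y = refl
  Δyʲ-Δxⁱ-comm j (suc i) f = ≐-trans (Δyʲ-Δx-comm j _) (Δx-cong (Δyʲ-Δxⁱ-comm j i f))

  Δxy-Δxy : ∀ a b i j f → Δxy F a b (Δxy F i j f) ≐ Δxy F (a ℕ.+ i) (b ℕ.+ j) f
  Δxy-Δxy a b i j f = ≐-trans (iter-cong Δx-cong a (Δyʲ-Δxⁱ-comm b i _)) (≡⇒≐ (≡.sym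
    (≡.trans (iter-+ (Δx F) a i _) (≡.cong (iter a (Δx F) ∘ iter i (Δx F)) (iter-+ (Δy F) b j f)))))

  Δxy-Δx : ∀ i j f → Δxy F i j (Δx F f) ≐ Δxy F (suc i) j f
  Δxy-Δx i j f = ≐-trans (iter-cong Δx-cong i (Δyʲ-Δx-comm j f)) (≡⇒≐ (iter-comm (Δx F) i _))

  Δxy-Δy : ∀ i j f → Δxy F i j (Δy F f) ≐ Δxy F i (suc j) f
  Δxy-Δy i j f = ≡⇒≐ (≡.cong (iter i (Δx F)) (iter-comm (Δy F) j f))

  minusScaled : Fn → Carrier → Fn → Fn
  minusScaled f z g x y = f x y - z * g x y

  Span-minusScaled : ∀ {k l f g} z → Span k l f → Span k l g → Span k l (minusScaled f z g)
  Span-minusScaled {g = g} z sf sg =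
    Span-cong (λ x y → +-congˡ (-‿distribˡ-* z (g x y))) (Span-+ sf (Span-* (- z) sg))
    where open import Algebra.Properties.Ring ring using (-‿distribˡ-*)

  minusScaled-Δ : ∀ a b c d z → (a - z * b) - (c - z * d) ≈ (a - c) - z * (b - d)
  minusScaled-Δ =
    solve 5 (λ a b c d z → (a :- z :* b) :- (c :- z :* d) := (a :- c) :- z :* (b :- d)) refl

  Δxy-minusScaled : ∀ i j f z g →
                    Δxy F i j (minusScaled f z g) ≐ minusScaled (Δxy F i j f) z (Δxy F i j g)
  Δxy-minusScaled i j f z g =
    ≐-trans (iter-cong Δx-cong i (iter-minusScaled Δy-cong Δy-minusScaled j f g))
            (iter-minusScaled Δx-cong Δx-minusScaled i _ _)
    where
    Δx-minusScaled : ∀ f g → Δx F (minusScaled f z g) ≐ minusScaled (Δx F f) z (Δx F g)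
    Δx-minusScaled f g x y = minusScaled-Δ (f x y) (g x y) (f (x - 1#) y) (g (x - 1#) y) z
    Δy-minusScaled : ∀ f g → Δy F (minusScaled f z g) ≐ minusScaled (Δy F f) z (Δy F g)
    Δy-minusScaled f g x y = minusScaled-Δ (f x y) (g x y) (f x (y - 1#)) (g x (y - 1#)) z
    iter-minusScaled : ∀ {D : Fn → Fn} → (∀ {f g} → f ≐ g → D f ≐ D g) →
                       (∀ f g → D (minusScaled f z g) ≐ minusScaled (D f) z (D g)) →
                       ∀ n f g → iter n D (minusScaled f z g) ≐ minusScaled (iter n D f) z (iter n D g)
    iter-minusScaled D-cong D-lin zero f g x y = refl
    iter-minusScaled D-cong D-lin (suc n) f g =
      ≐-trans (D-cong (iter-minusScaled D-cong D-lin n f g)) (D-lin _ _)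

  ε-cong : ∀ {f g} → f ≐ g → ∀ w → ε F f w ≈ ε F g w
  ε-cong f≐g (u , v) = f≐g u v

  HasZeroData : ℕ → ℕ → NodeSet F → Fn → Set ℓ
  HasZeroData k l W f = ∀ i j → i < k → j < l → ε F (Δxy F i j f) (W i j) ≈ 0#

  HasZeroData-cong : ∀ {k l W f g} → f ≐ g → HasZeroData k l W g → HasZeroData k l W f
  HasZeroData-cong {W = W} f≐g zero-data i j i<k j<l =
    trans (ε-cong (Δxy-cong i j f≐g) (W i j)) (zero-data i j i<k j<l)

  HasZeroData-Δx : ∀ {k l W f} → HasZeroData (suc k) l W f →
                   HasZeroData k l (λ i → W (suc i)) (Δx F f)
  HasZeroData-Δx {W = W} {f} zero-data i j i<k j<l =
    trans (ε-cong (Δxy-Δx i j f) (W (suc i) j)) (zero-data (suc i) j (s≤s i<k) j<l)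

  HasZeroData-Δy : ∀ {k l W f} → HasZeroData k (suc l) W f →
                   HasZeroData k l (λ i j → W i (suc j)) (Δy F f)
  HasZeroData-Δy {W = W} {f} zero-data i j i<k j<l =
    trans (ε-cong (Δxy-Δy i j f) (W i (suc j))) (zero-data i (suc j) i<k (s≤s j<l))

  ι-Cancellative : Set (c Level.⊔ ℓ)
  ι-Cancellative = ∀ b {z} → ι F (suc b) * z ≈ 0# → z ≈ 0#

  module Unisolvence (ι-cancel : ι-Cancellative) where

    coefficients-vanish-row : ∀ l cf W → HasZeroData 1 l W (risingSum² 1 l cf) →
                              ∀ b → b < l → cf 0 b ≈ 0#
    coefficients-vanish-row (suc l) cf W zero-data = vanish
      where
      f : Fn
      f = risingSum² 1 (suc l) cf
      Δyf : Span 1 l (Δy F f)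
      Δyf = Span-Δy {1} {suc l} (span cf λ _ _ → refl)
      tail : ∀ b → b < l → cf 0 (suc b) ≈ 0#
      tail b b<l = ι-cancel b (coefficients-vanish-row l (Span.coefficients Δyf) _
        (HasZeroData-cong (≐-sym (Span.expansion Δyf)) (HasZeroData-Δy zero-data)) b b<l)
      f≐const : f ≐ λ _ _ → cf 0 0
      f≐const x y = begin
        0# + risingSum (suc l) (cf 0) y * 1#
          ≈⟨ +-congˡ (*-congʳ (risingSum-truncate (ℕP.≤⇒≤′ (s≤s z≤n))
                                 λ { (suc b) _ (s≤s b<l) → tail b b<l })) ⟩
        0# + (0# + cf 0 0 * 1#) * 1#
          ≈⟨ solve 1 (λ c → con (+ 0) :+ (con (+ 0) :+ c :* con (+ 1)) :* con (+ 1) := c) refl (cf 0 0) ⟩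
        cf 0 0
          ∎
      vanish : ∀ b → b < suc l → cf 0 b ≈ 0#
      vanish zero _ = trans (sym (ε-cong f≐const (W 0 0))) (zero-data 0 0 (s≤s z≤n) (s≤s z≤n))
      vanish (suc b) (s≤s b<l) = tail b b<l

    coefficients-vanish : ∀ k l cf W → HasZeroData k l W (risingSum² k l cf) →
                          ∀ a b → a < k → b < l → cf a b ≈ 0#
    coefficients-vanish (suc k) l cf W zero-data = vanish
      where
      f : Fn
      f = risingSum² (suc k) l cf
      Δxf : Span k l (Δx F f)
      Δxf = Span-Δx {suc k} {l} (span cf λ _ _ → refl)
      tail : ∀ a b → a < k → b < l → cf (suc a) b ≈ 0#
      tail a b a<k b<l = ι-cancel a (coefficients-vanish k l (Span.coefficients Δxf) _
        (HasZeroData-cong (≐-sym (Span.expansion Δxf)) (HasZeroData-Δx zero-data)) a b a<k b<l)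
      f≐row : f ≐ risingSum² 1 l cf
      f≐row x y = risingSum-truncate (ℕP.≤⇒≤′ (s≤s z≤n))
        λ { (suc a) _ (s≤s a<k) → risingSum-zero l y (λ b → tail a b a<k) }
      vanish : ∀ a b → a < suc k → b < l → cf a b ≈ 0#
      vanish zero b _ b<l = coefficients-vanish-row l cf W (HasZeroData-cong (≐-sym f≐row)
        λ { zero j _ j<l → zero-data 0 j (s≤s z≤n) j<l ; (suc i) j (s≤s ()) _ }) b b<l
      vanish (suc a) b (s≤s a<k) b<l = tail a b a<k b<l

    unisolvent : ∀ {k l f} W → Span k l f → HasZeroData k l W f → f ≐ λ _ _ → 0#
    unisolvent {k} {l} W (span cf f≐) zero-data x y = trans (f≐ x y)
      (risingSum-zero k x λ a a<k → risingSum-zero l y λ b b<l →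
        coefficients-vanish k l cf W (HasZeroData-cong (≐-sym f≐) zero-data) a b a<k b<l)

module Gtilde {c ℓ : Level} (F : CommutativeRing c ℓ) where
  open CommutativeRing F
  open RisingFactorials F
  open import Relation.Binary.Reasoning.Setoid setoid

  ι-* : ∀ a b → ι F (a ℕ.* b) ≈ ι F a * ι F b
  ι-* a b = begin
    ι F (a ℕ.* b)           ≡⟨ ι≡×1 (a ℕ.* b) ⟩
    (a ℕ.* b) ×ᵤ 1#         ≈⟨ ×1-homo-* a b ⟩
    (a ×ᵤ 1#) * (b ×ᵤ 1#)   ≡⟨ ≡.cong₂ _*_ (ι≡×1 a) (ι≡×1 b) ⟨
    ι F a * ι F b           ∎
    where
    open import Algebra.Properties.Semiring.Mult semiring using (×1-homo-*) renaming (_×_ to _×ᵤ_)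
    ι≡×1 : ∀ n → ι F n ≡ n ×ᵤ 1#
    ι≡×1 zero = ≡.refl
    ι≡×1 (suc n) = ≡.cong (_+_ 1#) (ι≡×1 n)

  δ-+ : ∀ {m i} a → i ≤ m → δ F m (a ℕ.+ i) ≡ δ F (m ∸ i) a
  δ-+ {m} a z≤n = ≡.cong (δ F m) (ℕP.+-identityʳ a)
  δ-+ {suc m} {suc i} a (s≤s i≤m) = ≡.trans (≡.cong (δ F (suc m)) (ℕP.+-suc a i)) (δ-+ a i≤m)

  IsGtilde-data : ∀ {m n W p} → IsGtilde F m n W p → ∀ {a b} → a ≤ m → b ≤ n →
                  ε F (Δxy F a b (⟦_⟧ F p)) (W a b) ≈ ι F (m ! ℕ.* n !) * (δ F m a * δ F n b)
  IsGtilde-data {m} {n} {W} {p} isGtilde a≤m b≤n =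
    ≡.subst₂ (λ a b → ε F (Δxy F a b (⟦_⟧ F p)) (W a b) ≈ ι F (m ! ℕ.* n !) * (δ F m a * δ F n b))
             (FinP.toℕ-fromℕ< (s≤s a≤m)) (FinP.toℕ-fromℕ< (s≤s b≤n))
             (isGtilde (fromℕ< (s≤s a≤m)) (fromℕ< (s≤s b≤n)))

  gtilde-rescaling : ∀ {m n i j} a b → i ≤ m → j ≤ n →
    ι F (m ! ℕ.* n !) * (δ F m (a ℕ.+ i) * δ F n (b ℕ.+ j))
      ≈ ι F (falling m i ℕ.* falling n j)
          * (ι F ((m ∸ i) ! ℕ.* (n ∸ j) !) * (δ F (m ∸ i) a * δ F (n ∸ j) b))
  gtilde-rescaling {m} {n} {i} {j} a b i≤m j≤n = begin
    ι F (m ! ℕ.* n !) * (δ F m (a ℕ.+ i) * δ F n (b ℕ.+ j))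
      ≡⟨ ≡.cong₂ (λ k d → ι F k * d) (≡.sym factorials) (≡.cong₂ _*_ (δ-+ a i≤m) (δ-+ b j≤n)) ⟩
    ι F (K ℕ.* L) * δs   ≈⟨ *-congʳ (ι-* K L) ⟩
    (ι F K * ι F L) * δs ≈⟨ *-assoc _ _ _ ⟩
    ι F K * (ι F L * δs) ∎
    where
    K = falling m i ℕ.* falling n j
    L = (m ∸ i) ! ℕ.* (n ∸ j) !
    δs = δ F (m ∸ i) a * δ F (n ∸ j) b
    open import Algebra.Properties.CommutativeSemigroup ℕP.*-commutativeSemigroup using (interchange)
    factorials : K ℕ.* L ≡ m ! ℕ.* n !
    factorials = ≡.trans (interchange (falling m i) (falling n j) ((m ∸ i) !) ((n ∸ j) !))
                         (≡.cong₂ ℕ._*_ (falling*[m∸i]!≡m! i≤m) (falling*[m∸i]!≡m! j≤n))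

  Δxy-gtilde : ι-Cancellative →
    ∀ {m n i j Z g h} → IsGtilde F m n Z g → i ≤ m → j ≤ n →
    IsGtilde F (m ∸ i) (n ∸ j) (LD i j Z) h →
    Δxy F i j (⟦_⟧ F g) ≐ λ x y → ι F (falling m i ℕ.* falling n j) * ⟦_⟧ F h x y
  Δxy-gtilde ι-cancel {m} {n} {i} {j} {Z} {g} {h} g-isGtilde i≤m j≤n h-isGtilde x y =
    x∙y⁻¹≈ε⇒x≈y _ _ (Unisolvence.unisolvent ι-cancel (LD i j Z) D-span D-zero-data x y)
    where
    open import Algebra.Properties.Ring ring using (x∙y⁻¹≈ε⇒x≈y)
    K = falling m i ℕ.* falling n j
    G H D : Fn
    G = ⟦_⟧ F g
    H = ⟦_⟧ F h
    D = minusScaled (Δxy F i j G) (ι F K) H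
    D-span : Span (suc (m ∸ i)) (suc (n ∸ j)) D
    D-span = Span-minusScaled (ι F K)
      (≡.subst₂ (λ k l → Span k l (Δxy F i j G)) (ℕP.+-∸-assoc 1 i≤m) (ℕP.+-∸-assoc 1 j≤n)
                (Span-Δxy i j (Span-poly g)))
      (Span-poly h)
    D-zero-data : HasZeroData (suc (m ∸ i)) (suc (n ∸ j)) (LD i j Z) D
    D-zero-data a b (s≤s a≤m∸i) (s≤s b≤n∸j) = begin
      ε F (Δxy F a b D) w
        ≈⟨ ε-cong (Δxy-minusScaled a b (Δxy F i j G) (ι F K) H) w ⟩
      ε F (Δxy F a b (Δxy F i j G)) w - ι F K * ε F (Δxy F a b H) w
        ≈⟨ +-congʳ (ε-cong (Δxy-Δxy a b i j G) w) ⟩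
      ε F (Δxy F (a ℕ.+ i) (b ℕ.+ j) G) w - ι F K * ε F (Δxy F a b H) w
        ≈⟨ +-cong (IsGtilde-data {W = Z} {g} g-isGtilde
                    (ℕP.m≤o∸n⇒m+n≤o a i≤m a≤m∸i) (ℕP.m≤o∸n⇒m+n≤o b j≤n b≤n∸j))
                  (-‿cong (*-congˡ (IsGtilde-data {W = LD i j Z} {h} h-isGtilde a≤m∸i b≤n∸j))) ⟩
      ι F (m ! ℕ.* n !) * (δ F m (a ℕ.+ i) * δ F n (b ℕ.+ j)) - ι F K * h-data
        ≈⟨ +-congʳ (gtilde-rescaling a b i≤m j≤n) ⟩
      ι F K * h-data - ι F K * h-data
        ≈⟨ -‿inverseʳ _ ⟩
      0# ∎
      where
      w = LD i j Z a b
      h-data = ι F ((m ∸ i) ! ℕ.* (n ∸ j) !) * (δ F (m ∸ i) a * δ F (n ∸ j) b)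

  Δxy-vanishes : ∀ {m n i j f} → Span (suc m) (suc n) f → m < i ⊎ n < j → Δxy F i j f ≐ λ _ _ → 0#
  Δxy-vanishes {m} {n} {i} {j} {f} f-span (inj₁ m<i) = Span-zeroˡ
    (≡.subst (λ k → Span k (suc n ∸ j) (Δxy F i j f)) (ℕP.m≤n⇒m∸n≡0 m<i) (Span-Δxy i j f-span))
  Δxy-vanishes {m} {n} {i} {j} {f} f-span (inj₂ n<j) = Span-zeroʳ
    (≡.subst (λ l → Span (suc m ∸ i) l (Δxy F i j f)) (ℕP.m≤n⇒m∸n≡0 n<j) (Span-Δxy i j f-span))

  field⇒ι-cancel : IsField F → CharZero F → ι-Cancellative
  field⇒ι-cancel (_ , inverse) charZero b {z} ιz≈0 with inverse (ι F (suc b)) (charZero b)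
  ... | y , ιy≈1 = begin
    z                      ≈⟨ *-identityˡ z ⟨
    1# * z                 ≈⟨ *-congʳ ιy≈1 ⟨
    (ι F (suc b) * y) * z  ≈⟨ trans (*-assoc _ _ _) (x∙yz≈y∙xz _ y z) ⟩
    y * (ι F (suc b) * z)  ≈⟨ *-congˡ ιz≈0 ⟩
    y * 0#                 ≈⟨ zeroʳ y ⟩
    0#                     ∎
    where open import Algebra.Properties.CommutativeSemigroup *-commutativeSemigroup using (x∙yz≈y∙xz)

corollary6 : ∀ {c ℓ} (F : CommutativeRing c ℓ) → IsField F → CharZero F →
    (Z : NodeSet F) (m n i j : ℕ) (g : Poly F m n) → IsGtilde F m n Z g →
    ((i ≤ m × j ≤ n) →
      (h : Poly F (m ∸ i) (n ∸ j)) → IsGtilde F (m ∸ i) (n ∸ j) (LD i j Z) h →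
      ∀ x y → CommutativeRing._≈_ F (Δxy F i j (⟦_⟧ F g) x y)
        (CommutativeRing._*_ F (ι F (falling m i Data.Nat.* falling n j)) (⟦_⟧ F h x y)))
    × ((m < i ⊎ n < j) →
      ∀ x y → CommutativeRing._≈_ F (Δxy F i j (⟦_⟧ F g) x y) (CommutativeRing.0# F))
corollary6 F isField charZero Z m n i j g g-isGtilde =
  (λ (i≤m , j≤n) h →
     Δxy-gtilde (field⇒ι-cancel isField charZero) {Z = Z} {g} {h} g-isGtilde i≤m j≤n) ,
  Δxy-vanishes {i = i} {j} (Span-poly g)
  where open RisingFactorials F using (Span-poly)
        open Gtilde F
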